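{- Let $m\geq 2$ and $\nu\geq 2$ be integers with $2^{\nu-1}\leq m<2^{\nu}$, and let $f_{m,n}(z)=\sum_{j=0}^{n}\binom{n}{j}z^{\binom{j}{m}}$. Then for all $n\geq 0$, \[\Delta^{2^{\nu}}f_{m,n}(-1)=f_{m,n}(-1).\] If moreover $m=2^k$ for some integer $k\geq 1$, then in addition for all $n\geq 0$, \[\Delta^{2^k}f_{2^k,n}(-1)=-f_{2^k,n}(-1).\]
   Context: Here $\binom{j}{m}=0$ for $0\le j<m$. The difference operator acts on the index $n$: $\Delta a_n=a_{n+1}-a_n$, $\Delta^0a_n=a_n$, $\Delta^{r+1}=\Delta\circ\Delta^r$, equivalently $\Delta^r a_n=\sum_{k=0}^r(-1)^k\binom{r}{k}a_{n+r-k}$. -}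

module Defs where

open import Data.Nat using (ℕ; zero; suc)
open import Data.Nat.Combinatorics using (_C_)
open import Data.Integer using (ℤ; +_; _+_; _-_; _*_; _^_; -1ℤ)

sumTo : ℕ → (ℕ → ℤ) → ℤ
sumTo zero    g = g 0
sumTo (suc n) g = sumTo n g + g (suc n)

-- f_{m,n}(-1) = Σ_{j=0}^{n} C(n,j) (-1)^{C(j,m)}, with C(j,m)=0 for j<m
fm1 : ℕ → ℕ → ℤ
fm1 m n = sumTo n (λ j → (+ (n C j)) * (-1ℤ ^ (j C m)))

Δ : (ℕ → ℤ) → ℕ → ℤ
Δ a n = a (suc n) - a n

Δ^ : ℕ → (ℕ → ℤ) → ℕ → ℤ
Δ^ zero    a = a
Δ^ (suc r) a = Δ (Δ^ r a)

-- f_{m,n}(-1) is the binomial transform of the sign sequence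
-- b_j = (-1)^C(j,m), and Δ acts on binomial transforms by shifting the
-- sequence, so Δ^r f_{m,n}(-1) is the binomial transform of j ↦ b_{j+r}.
-- For N = 2^ν one has C(j+N,m) ≡ C(j,m) + C(j,m-N) (mod 2): for ν = 0 this
-- is Pascal's rule, and the law for 2N follows by applying the law for N
-- twice. Hence b is N-periodic when m < N, and for m = 2^k a shift by 2^k
-- multiplies b by (-1)^C(j,0) = -1.
module Submission where

open import Defs
open import Data.Nat using (ℕ; _≤_; _<_; _^_; _∸_)
open import Data.Integer using (-_)
open import Data.Product using (_×_)
open import Relation.Binary.PropositionalEquality using (_≡_)

open import Data.Nat as ℕ using (zero; suc)
import Data.Nat.Properties as ℕ
open import Data.Nat.Combinatorics using (_C_; nCk+nC[k+1]≡[n+1]C[k+1])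
open import Data.Nat.Combinatorics.Specification using (k>n⇒nCk≡0)
open import Data.Integer as ℤ using (ℤ; +_; -1ℤ; 1ℤ; 0ℤ)
import Data.Integer.Properties as ℤ
open import Data.Integer.Tactic.RingSolver using (solve-∀)
open import Data.Product using (_,_)
open import Relation.Binary.PropositionalEquality
  using (refl; sym; trans; cong; cong₂; subst; module ≡-Reasoning)
open import Relation.Nullary using (yes; no)
open ≡-Reasoning

sumTo-cong : ∀ n {f g : ℕ → ℤ} → (∀ j → f j ≡ g j) → sumTo n f ≡ sumTo n g
sumTo-cong zero    f≗g = f≗g 0
sumTo-cong (suc n) f≗g = cong₂ ℤ._+_ (sumTo-cong n f≗g) (f≗g (suc n))

sumTo-distrib-+ : ∀ n (f g : ℕ → ℤ) →
  sumTo n (λ j → f j ℤ.+ g j) ≡ sumTo n f ℤ.+ sumTo n g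
sumTo-distrib-+ zero    f g = refl
sumTo-distrib-+ (suc n) f g =
  trans (cong (ℤ._+ (f (suc n) ℤ.+ g (suc n))) (sumTo-distrib-+ n f g))
        (interchange (sumTo n f) (sumTo n g) (f (suc n)) (g (suc n)))
  where
  interchange : ∀ a b c d → (a ℤ.+ b) ℤ.+ (c ℤ.+ d) ≡ (a ℤ.+ c) ℤ.+ (b ℤ.+ d)
  interchange = solve-∀

sumTo-neg : ∀ n (f : ℕ → ℤ) → sumTo n (λ j → - f j) ≡ - sumTo n f
sumTo-neg zero    f = refl
sumTo-neg (suc n) f = trans (cong (ℤ._+ (- f (suc n))) (sumTo-neg n f))
                            (sym (ℤ.neg-distrib-+ (sumTo n f) (f (suc n))))

sumTo-suc-head : ∀ n (f : ℕ → ℤ) → sumTo (suc n) f ≡ f 0 ℤ.+ sumTo n (λ j → f (suc j))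
sumTo-suc-head zero    f = refl
sumTo-suc-head (suc n) f = trans (cong (ℤ._+ f (suc (suc n))) (sumTo-suc-head n f))
                                 (ℤ.+-assoc (f 0) _ _)

sumTo-suc-last-zero : ∀ n (f : ℕ → ℤ) → f (suc n) ≡ 0ℤ → sumTo (suc n) f ≡ sumTo n f
sumTo-suc-last-zero n f f[n+1]≡0 =
  trans (cong (λ x → sumTo n f ℤ.+ x) f[n+1]≡0) (ℤ.+-identityʳ (sumTo n f))

binomialTransform : (ℕ → ℤ) → ℕ → ℤ
binomialTransform b n = sumTo n (λ j → + (n C j) ℤ.* b j)

binomialTransform-cong : ∀ n {b c : ℕ → ℤ} → (∀ j → b j ≡ c j) →
  binomialTransform b n ≡ binomialTransform c n
binomialTransform-cong n b≗c = sumTo-cong n (λ j → cong (+ (n C j) ℤ.*_) (b≗c j))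

binomialTransform-neg : ∀ n (b : ℕ → ℤ) →
  binomialTransform (λ j → - b j) n ≡ - binomialTransform b n
binomialTransform-neg n b =
  trans (sumTo-cong n (λ j → sym (ℤ.neg-distribʳ-* (+ (n C j)) (b j))))
        (sumTo-neg n _)

binomialSum-head : ∀ N n (b : ℕ → ℤ) →
  sumTo (suc n) (λ j → + (N C j) ℤ.* b j) ≡ b 0 ℤ.+ sumTo n (λ j → + (N C suc j) ℤ.* b (suc j))
binomialSum-head N n b = trans (sumTo-suc-head n _) (cong (ℤ._+ tail) (ℤ.*-identityˡ (b 0)))
  where
  tail : ℤ
  tail = sumTo n (λ j → + (N C suc j) ℤ.* b (suc j))

binomialTransform-head : ∀ n (b : ℕ → ℤ) →
  binomialTransform b n ≡ b 0 ℤ.+ sumTo n (λ j → + (n C suc j) ℤ.* b (suc j))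
binomialTransform-head n b =
  trans (sym (sumTo-suc-last-zero n _ top-vanishes)) (binomialSum-head n n b)
  where
  top-vanishes : + (n C suc n) ℤ.* b (suc n) ≡ 0ℤ
  top-vanishes = trans (cong (λ c → + c ℤ.* b (suc n)) (k>n⇒nCk≡0 (ℕ.n<1+n n)))
                       (ℤ.*-zeroˡ (b (suc n)))

pascal-* : ∀ n j x → + (suc n C suc j) ℤ.* x ≡ + (n C j) ℤ.* x ℤ.+ + (n C suc j) ℤ.* x
pascal-* n j x = begin
  + (suc n C suc j) ℤ.* x
    ≡⟨ cong (λ c → + c ℤ.* x) (sym (nCk+nC[k+1]≡[n+1]C[k+1] n j)) ⟩
  + (n C j ℕ.+ n C suc j) ℤ.* x
    ≡⟨ cong (ℤ._* x) (ℤ.pos-+ (n C j) (n C suc j)) ⟩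
  (+ (n C j) ℤ.+ + (n C suc j)) ℤ.* x
    ≡⟨ ℤ.*-distribʳ-+ x (+ (n C j)) (+ (n C suc j)) ⟩
  + (n C j) ℤ.* x ℤ.+ + (n C suc j) ℤ.* x ∎

Δ-binomialTransform : ∀ (b : ℕ → ℤ) n →
  Δ (binomialTransform b) n ≡ binomialTransform (λ j → b (suc j)) n
Δ-binomialTransform b n = begin
  binomialTransform b (suc n) ℤ.- binomialTransform b n
    ≡⟨ cong₂ ℤ._-_ (binomialSum-head (suc n) n b) (binomialTransform-head n b) ⟩
  (b 0 ℤ.+ sumTo n (λ j → + (suc n C suc j) ℤ.* b (suc j))) ℤ.- (b 0 ℤ.+ tail)
    ≡⟨ cong (λ s → (b 0 ℤ.+ s) ℤ.- (b 0 ℤ.+ tail))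
            (trans (sumTo-cong n (λ j → pascal-* n j (b (suc j))))
                   (sumTo-distrib-+ n _ _)) ⟩
  (b 0 ℤ.+ (binomialTransform (λ j → b (suc j)) n ℤ.+ tail)) ℤ.- (b 0 ℤ.+ tail)
    ≡⟨ cancel (b 0) _ tail ⟩
  binomialTransform (λ j → b (suc j)) n ∎
  where
  tail : ℤ
  tail = sumTo n (λ j → + (n C suc j) ℤ.* b (suc j))
  cancel : ∀ x y z → (x ℤ.+ (y ℤ.+ z)) ℤ.- (x ℤ.+ z) ≡ y
  cancel = solve-∀

Δ^-binomialTransform : ∀ r (b : ℕ → ℤ) n →
  Δ^ r (binomialTransform b) n ≡ binomialTransform (λ j → b (j ℕ.+ r)) n
Δ^-binomialTransform zero    b n = binomialTransform-cong n (λ j → cong b (sym (ℕ.+-identityʳ j)))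
Δ^-binomialTransform (suc r) b n = begin
  Δ^ r (binomialTransform b) (suc n) ℤ.- Δ^ r (binomialTransform b) n
    ≡⟨ cong₂ ℤ._-_ (Δ^-binomialTransform r b (suc n)) (Δ^-binomialTransform r b n) ⟩
  Δ (binomialTransform (λ j → b (j ℕ.+ r))) n
    ≡⟨ Δ-binomialTransform _ n ⟩
  binomialTransform (λ j → b (suc j ℕ.+ r)) n
    ≡⟨ binomialTransform-cong n (λ j → cong b (sym (ℕ.+-suc j r))) ⟩
  binomialTransform (λ j → b (j ℕ.+ suc r)) n ∎

sign : ℕ → ℕ → ℤ
sign m j = -1ℤ ℤ.^ (j C m)

-1^n*-1^n≡1 : ∀ n → -1ℤ ℤ.^ n ℤ.* -1ℤ ℤ.^ n ≡ 1ℤ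
-1^n*-1^n≡1 zero    = refl
-1^n*-1^n≡1 (suc n) = trans (square-neg (-1ℤ ℤ.^ n)) (-1^n*-1^n≡1 n)
  where
  square-neg : ∀ x → (-1ℤ ℤ.* x) ℤ.* (-1ℤ ℤ.* x) ≡ x ℤ.* x
  square-neg = solve-∀

*-sign-sign : ∀ x m j → x ℤ.* sign m j ℤ.* sign m j ≡ x
*-sign-sign x m j = trans (ℤ.*-assoc x _ _)
  (trans (cong (x ℤ.*_) (-1^n*-1^n≡1 (j C m))) (ℤ.*-identityʳ x))

sign-pascal : ∀ m j → sign (suc m) (suc j) ≡ sign (suc m) j ℤ.* sign m j
sign-pascal m j = begin
  -1ℤ ℤ.^ (suc j C suc m)
    ≡⟨ cong (-1ℤ ℤ.^_) (sym (nCk+nC[k+1]≡[n+1]C[k+1] j m)) ⟩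
  -1ℤ ℤ.^ (j C m ℕ.+ j C suc m)
    ≡⟨ ℤ.^-distribˡ-+-* -1ℤ (j C m) (j C suc m) ⟩
  sign m j ℤ.* sign (suc m) j
    ≡⟨ ℤ.*-comm (sign m j) _ ⟩
  sign (suc m) j ℤ.* sign m j ∎

-- The shift law C(j+N,m) ≡ C(j,m) + C(j,m-N) (mod 2), split at m = N.
record SignShift (N : ℕ) : Set where
  field
    below : ∀ j m → m < N → sign m (j ℕ.+ N) ≡ sign m j
    above : ∀ j d → sign (d ℕ.+ N) (j ℕ.+ N) ≡ sign (d ℕ.+ N) j ℤ.* sign d j

signShift-1 : SignShift 1
signShift-1 = record { below = below ; above = above }
  where
  below : ∀ j m → m < 1 → sign m (j ℕ.+ 1) ≡ sign m j
  below j zero ℕ.z<s = refl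
  above : ∀ j d → sign (d ℕ.+ 1) (j ℕ.+ 1) ≡ sign (d ℕ.+ 1) j ℤ.* sign d j
  above j d rewrite ℕ.+-comm d 1 | ℕ.+-comm j 1 = sign-pascal d j

signShift-double : ∀ {N} → SignShift N → SignShift (N ℕ.+ N)
signShift-double {N} shiftN = record { below = below ; above = above }
  where
  open SignShift shiftN renaming (below to belowN; above to aboveN)

  below-upperHalf : ∀ j d → d < N → sign (d ℕ.+ N) ((j ℕ.+ N) ℕ.+ N) ≡ sign (d ℕ.+ N) j
  below-upperHalf j d d<N = begin
    sign (d ℕ.+ N) ((j ℕ.+ N) ℕ.+ N)
      ≡⟨ aboveN (j ℕ.+ N) d ⟩
    sign (d ℕ.+ N) (j ℕ.+ N) ℤ.* sign d (j ℕ.+ N)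
      ≡⟨ cong₂ ℤ._*_ (aboveN j d) (belowN j d d<N) ⟩
    sign (d ℕ.+ N) j ℤ.* sign d j ℤ.* sign d j
      ≡⟨ *-sign-sign (sign (d ℕ.+ N) j) d j ⟩
    sign (d ℕ.+ N) j ∎

  below : ∀ j m → m < N ℕ.+ N → sign m (j ℕ.+ (N ℕ.+ N)) ≡ sign m j
  below j m m<2N rewrite sym (ℕ.+-assoc j N N) with m ℕ.<? N
  ... | yes m<N = trans (belowN (j ℕ.+ N) m m<N) (belowN j m m<N)
  ... | no m≮N = subst (λ i → sign i ((j ℕ.+ N) ℕ.+ N) ≡ sign i j) m∸N+N≡m
                       (below-upperHalf j (m ∸ N) m∸N<N)
    where
    m∸N+N≡m : m ∸ N ℕ.+ N ≡ m
    m∸N+N≡m = ℕ.m∸n+n≡m (ℕ.≮⇒≥ m≮N)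
    m∸N<N : m ∸ N < N
    m∸N<N = ℕ.+-cancelʳ-< N (m ∸ N) N (subst (_< N ℕ.+ N) (sym m∸N+N≡m) m<2N)

  above : ∀ j d → sign (d ℕ.+ (N ℕ.+ N)) (j ℕ.+ (N ℕ.+ N))
                ≡ sign (d ℕ.+ (N ℕ.+ N)) j ℤ.* sign d j
  above j d rewrite sym (ℕ.+-assoc j N N) | sym (ℕ.+-assoc d N N) = begin
    sign ((d ℕ.+ N) ℕ.+ N) ((j ℕ.+ N) ℕ.+ N)
      ≡⟨ aboveN (j ℕ.+ N) (d ℕ.+ N) ⟩
    sign ((d ℕ.+ N) ℕ.+ N) (j ℕ.+ N) ℤ.* sign (d ℕ.+ N) (j ℕ.+ N)
      ≡⟨ cong₂ ℤ._*_ (aboveN j (d ℕ.+ N)) (aboveN j d) ⟩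
    (x ℤ.* y) ℤ.* (y ℤ.* w)
      ≡⟨ regroup x y w ⟩
    x ℤ.* w ℤ.* y ℤ.* y
      ≡⟨ *-sign-sign (x ℤ.* w) (d ℕ.+ N) j ⟩
    x ℤ.* w ∎
    where
    x y w : ℤ
    x = sign ((d ℕ.+ N) ℕ.+ N) j
    y = sign (d ℕ.+ N) j
    w = sign d j
    regroup : ∀ x y w → (x ℤ.* y) ℤ.* (y ℤ.* w) ≡ x ℤ.* w ℤ.* y ℤ.* y
    regroup = solve-∀

signShift-2^ : ∀ ν → SignShift (2 ^ ν)
signShift-2^ zero    = signShift-1
signShift-2^ (suc ν) = subst SignShift (cong (2 ^ ν ℕ.+_) (sym (ℕ.+-identityʳ (2 ^ ν))))
                             (signShift-double (signShift-2^ ν))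

sign-periodic : ∀ ν {m} → m < 2 ^ ν → ∀ j → sign m (j ℕ.+ 2 ^ ν) ≡ sign m j
sign-periodic ν m<2^ν j = SignShift.below (signShift-2^ ν) j _ m<2^ν

sign-antiperiodic : ∀ k j → sign (2 ^ k) (j ℕ.+ 2 ^ k) ≡ - sign (2 ^ k) j
sign-antiperiodic k j =
  trans (SignShift.above (signShift-2^ k) j 0)
        (trans (ℤ.*-comm _ -1ℤ) (ℤ.-1*i≡-i _))

corollary2p6 : (m ν : ℕ) → 2 ≤ m → 2 ≤ ν → 2 ^ (ν ∸ 1) ≤ m → m < 2 ^ ν →
    ((n : ℕ) → Δ^ (2 ^ ν) (fm1 m) n ≡ fm1 m n)
    × ((k : ℕ) → 1 ≤ k → m ≡ 2 ^ k →
    (n : ℕ) → Δ^ (2 ^ k) (fm1 (2 ^ k)) n ≡ - fm1 (2 ^ k) n)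
corollary2p6 m ν _ _ _ m<2^ν = periodic , antiperiodic
  where
  periodic : (n : ℕ) → Δ^ (2 ^ ν) (fm1 m) n ≡ fm1 m n
  periodic n = trans (Δ^-binomialTransform (2 ^ ν) (sign m) n)
                     (binomialTransform-cong n (sign-periodic ν m<2^ν))
  antiperiodic : (k : ℕ) → 1 ≤ k → m ≡ 2 ^ k →
    (n : ℕ) → Δ^ (2 ^ k) (fm1 (2 ^ k)) n ≡ - fm1 (2 ^ k) n
  antiperiodic k _ _ n = begin
    Δ^ (2 ^ k) (binomialTransform (sign (2 ^ k))) n
      ≡⟨ Δ^-binomialTransform (2 ^ k) (sign (2 ^ k)) n ⟩
    binomialTransform (λ j → sign (2 ^ k) (j ℕ.+ 2 ^ k)) n
      ≡⟨ binomialTransform-cong n (sign-antiperiodic k) ⟩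
    binomialTransform (λ j → - sign (2 ^ k) j) n
      ≡⟨ binomialTransform-neg n (sign (2 ^ k)) ⟩
    - binomialTransform (sign (2 ^ k)) n ∎
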